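{- Let $t\ge 2$ and $n\ge t+1$ be integers, $N=n-t$, and let $\Delta:[1-t,n-t]\to\{0,1\}$ be a $2$-coloring. Let $a=|\Delta^{ -1}(0)\cap[1-t,-1]|$, let $\varepsilon=1$ if $\Delta(0)=0$ and $\varepsilon=0$ otherwise, and set $s_0=a+\varepsilon$, $s_1=t-a-\varepsilon$. Let $N_{QQQ}$ be the number of triples $(x_1,x_2,x_3)$ with $x_1,x_2,x_3\in[1-t,0]$, $x_1\le x_2\le x_3$, $x_1+x_2<x_3$ and $\Delta(x_1)=\Delta(x_2)=\Delta(x_3)$. Then \[ N_{QQQ}=\binom{s_0+2}{3}+\binom{s_1+2}{3}-1. \]
   Context: For integers $a\le b$, $[a,b]=\{m\in\mathbb Z:a\le m\le b\}$. Note $s_0$ and $s_1$ are the numbers of elements of $[1-t,0]$ of colors $0$ and $1$ respectively. -}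

module Defs where

open import Data.Bool using (if_then_else_)
open import Data.Nat as ℕ using (ℕ; zero; suc)
open import Data.Integer as ℤ using (ℤ; +_; -_; _+_; _-_; _≤ᵇ_)
open import Data.Integer.Properties as ℤP using ()
open import Data.Fin using (Fin) renaming (zero to f0)
open import Data.Fin.Properties as FinP using ()
open import Data.List using (List; []; _∷_; map; upTo; length; filter; concatMap)
open import Data.Product using (_×_; _,_)
open import Relation.Nullary.Decidable using (_×-dec_)
open import Relation.Binary.PropositionalEquality using (_≡_)

[_,_] : ℤ → ℤ → List ℤ
[ a , b ] = if a ≤ᵇ b then map (λ k → a + + k) (upTo (suc ℤ.∣ b - a ∣)) else []

-- A 2-colouring; only its values on [1-t, n-t] are ever used.
Colouring : Set
Colouring = ℤ → Fin 2

count0 : Colouring → List ℤ → ℕ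
count0 Δ xs = length (filter (λ x → Δ x FinP.≟ f0) xs)

aCount : ℕ → Colouring → ℕ
aCount t Δ = count0 Δ [ + 1 - + t , - + 1 ]

eps : Colouring → ℕ
eps Δ = count0 Δ (+ 0 ∷ [])

s₀ : ℕ → Colouring → ℕ
s₀ t Δ = aCount t Δ ℕ.+ eps Δ

s₁ : ℕ → Colouring → ℕ
s₁ t Δ = t ℕ.∸ aCount t Δ ℕ.∸ eps Δ

triples : List ℤ → List (ℤ × ℤ × ℤ)
triples xs = concatMap (λ x₁ → concatMap (λ x₂ → map (λ x₃ → x₁ , x₂ , x₃) xs) xs) xs

Good : Colouring → ℤ × ℤ × ℤ → Set
Good Δ (x₁ , x₂ , x₃) =
  (x₁ ℤ.≤ x₂) × (x₂ ℤ.≤ x₃) × (x₁ + x₂ ℤ.< x₃) × (Δ x₁ ≡ Δ x₂) × (Δ x₂ ≡ Δ x₃)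

good? : (Δ : Colouring) → (p : ℤ × ℤ × ℤ) → Relation.Nullary.Decidable.Dec (Good Δ p)
good? Δ (x₁ , x₂ , x₃) =
  (x₁ ℤ.≤? x₂) ×-dec (x₂ ℤ.≤? x₃) ×-dec (x₁ + x₂ ℤ.<? x₃)
    ×-dec (Δ x₁ FinP.≟ Δ x₂) ×-dec (Δ x₂ FinP.≟ Δ x₃)

NQQQ : ℕ → Colouring → ℕ
NQQQ t Δ = length (filter (good? Δ) (triples [ + 1 - + t , + 0 ]))

{-# OPTIONS --safe #-}
-- On [1-t, 0] all entries are ≤ 0, so for x₁ ≤ x₂ ≤ x₃ the condition x₁ + x₂ < x₃ holds exactly when x₁ < 0:
-- N_QQQ counts the monochromatic weakly increasing triples except (0, 0, 0). Peeling off the least element x < 0,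
-- the new triples are x followed by a weakly increasing pair of colour Δ x, (k+1 choose 2) of them when that colour
-- occurs k times from x on; Pascal's rule turns these into the (s+2 choose 3) multisets of each colour class.
module Submission where

open import Defs
open import Data.Nat using (ℕ; _+_; _∸_; _≤_; _≥_)
open import Data.Nat.Combinatorics using (_C_)
open import Relation.Binary.PropositionalEquality using (_≡_)

open import Data.Nat using (zero; suc)
open import Data.Nat.Properties using (+-assoc; +-comm; m+n∸n≡m; m+n∸m≡n; ∸-+-assoc)
open import Data.Nat.Combinatorics using (nCk+nC[k+1]≡[n+1]C[k+1]; nC1≡n)
open import Data.Nat.ListAction using (sum)
open import Data.Integer as ℤ using (ℤ; +_; -_; _-_; 0ℤ; +<+)
open import Data.Integer.Properties as ℤP using (+-monoʳ-<; +-monoˡ-<; +-identityˡ; +-inverseˡ; <⇒≱; ≤-refl; <⇒≤)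
open import Data.Fin using (Fin; opposite) renaming (zero to f0; suc to fs)
open import Data.Fin.Properties using (_≟_)
open import Data.List using (List; []; _∷_; _++_; _∷ʳ_; map; length; filter; concatMap; upTo)
open import Data.List.Properties
  using (map-cong; map-cong-local; filter-++; length-++; filter-accept; filter-reject; filter-none;
         map-++; length-map; upTo-∷ʳ; length-upTo)
open import Data.List.Relation.Unary.All as All using (All; []; _∷_)
import Data.List.Relation.Unary.All.Properties as All
open import Data.List.Relation.Unary.AllPairs using (AllPairs; []; _∷_)
import Data.List.Relation.Unary.AllPairs.Properties as AllPairs
open import Data.Bool using (true; false)
open import Data.Empty using (⊥-elim)
open import Data.Product using (_×_; _,_; proj₁; proj₂)
open import Function using (_∘_; id)
open import Function.Bundles using (_⇔_; mk⇔; Equivalence)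
open import Level using (0ℓ)
open import Relation.Nullary using (¬_; Dec; yes; no)
open import Relation.Nullary.Decidable using (_×-dec_)
open import Relation.Unary using (Pred; Decidable; ∁)
open import Relation.Binary.PropositionalEquality using (refl; sym; trans; cong; cong₂; subst; _≢_; module ≡-Reasoning)

count : {A : Set} {P : Pred A 0ℓ} → Decidable P → List A → ℕ
count P? xs = length (filter P? xs)

∑ : {A : Set} → List A → (A → ℕ) → ℕ
∑ xs f = sum (map f xs)

syntax ∑ xs (λ x → e) = ∑[ x ∈ xs ] e

∑-cong-local : {A : Set} {f g : A → ℕ} {xs : List A} → All (λ x → f x ≡ g x) xs → ∑ xs f ≡ ∑ xs g
∑-cong-local = cong sum ∘ map-cong-local

module _ {A : Set} {P : Pred A 0ℓ} (P? : Decidable P) where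

  count-++ : ∀ xs ys → count P? (xs ++ ys) ≡ count P? xs + count P? ys
  count-++ xs ys = trans (cong length (filter-++ P? xs ys)) (length-++ (filter P? xs))

  count-concatMap : {B : Set} (f : B → List A) (ys : List B) → count P? (concatMap f ys) ≡ ∑[ y ∈ ys ] count P? (f y)
  count-concatMap f []       = refl
  count-concatMap f (y ∷ ys) = trans (count-++ (f y) (concatMap f ys)) (cong₂ _+_ refl (count-concatMap f ys))

  count-none : {xs : List A} → All (∁ P) xs → count P? xs ≡ 0
  count-none = cong length ∘ filter-none P?

  count-reject : {x : A} (xs : List A) → ¬ P x → count P? (x ∷ xs) ≡ count P? xs
  count-reject xs = cong length ∘ filter-reject P?

  count-accept : {x : A} (xs : List A) → P x → count P? (x ∷ xs) ≡ suc (count P? xs)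
  count-accept xs = cong length ∘ filter-accept P?

  count-map : {B : Set} (g : B → A) (xs : List B) → count P? (map g xs) ≡ count (P? ∘ g) xs
  count-map g []       = refl
  count-map g (x ∷ xs) with P? (g x)
  ... | yes _ = cong suc (count-map g xs)
  ... | no _  = count-map g xs

count-cong-local : {A : Set} {P Q : Pred A 0ℓ} (P? : Decidable P) (Q? : Decidable Q) {xs : List A} →
                   All (λ x → P x ⇔ Q x) xs → count P? xs ≡ count Q? xs
count-cong-local P? Q? []                     = refl
count-cong-local P? Q? {x ∷ xs} (P⇔Q ∷ P⇔Qs) with P? x | Q? x
... | yes p | yes q = cong suc (count-cong-local P? Q? P⇔Qs)
... | yes p | no ¬q = ⊥-elim (¬q (Equivalence.to P⇔Q p))
... | no ¬p | yes q = ⊥-elim (¬p (Equivalence.from P⇔Q q))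
... | no ¬p | no ¬q = count-cong-local P? Q? P⇔Qs

tripleCount : {P : Pred (ℤ × ℤ × ℤ) 0ℓ} → Decidable P → List ℤ → ℕ
tripleCount P? xs = ∑[ x₁ ∈ xs ] ∑[ x₂ ∈ xs ] count (λ x₃ → P? (x₁ , x₂ , x₃)) xs

count-triples : {P : Pred (ℤ × ℤ × ℤ) 0ℓ} (P? : Decidable P) (xs : List ℤ) →
                count P? (triples xs) ≡ tripleCount P? xs
count-triples P? xs =
  trans (count-concatMap P? _ xs) (cong sum (map-cong (λ x₁ →
    trans (count-concatMap P? _ xs) (cong sum (map-cong (λ x₂ →
      count-map P? (λ x₃ → x₁ , x₂ , x₃) xs) xs))) xs))

-- A triple containing the least element x must start with x.
tripleCount-∷ : {P : Pred (ℤ × ℤ × ℤ) 0ℓ} (P? : Decidable P) →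
                (∀ {x₁ x₂ x₃} → P (x₁ , x₂ , x₃) → x₁ ℤ.≤ x₂ × x₂ ℤ.≤ x₃) →
                {x : ℤ} {xs : List ℤ} → All (x ℤ.<_) xs →
                tripleCount P? (x ∷ xs) ≡ ∑[ y ∈ x ∷ xs ] count (λ z → P? (x , y , z)) (x ∷ xs) + tripleCount P? xs
tripleCount-∷ P? ordered {x} {xs} x<xs = cong₂ _+_ refl (∑-cong-local (All.map dropFirst x<xs))
  where
  dropFirst : ∀ {x₁} → x ℤ.< x₁ →
              ∑[ x₂ ∈ x ∷ xs ] count (λ x₃ → P? (x₁ , x₂ , x₃)) (x ∷ xs) ≡ ∑[ x₂ ∈ xs ] count (λ x₃ → P? (x₁ , x₂ , x₃)) xs
  dropFirst x<x₁ = cong₂ _+_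
    (count-none (λ x₃ → P? (_ , x , x₃)) (All.universal (λ _ p → <⇒≱ x<x₁ (proj₁ (ordered p))) (x ∷ xs)))
    (∑-cong-local (All.map (λ x<x₂ → count-reject (λ x₃ → P? (_ , _ , x₃)) xs (λ p → <⇒≱ x<x₂ (proj₂ (ordered p)))) x<xs))

sumColours : (Fin 2 → ℕ) → ℕ
sumColours f = f f0 + f (fs f0)

sumColours-from : ∀ f c → sumColours f ≡ f c + f (opposite c)
sumColours-from f f0      = refl
sumColours-from f (fs f0) = +-comm (f f0) (f (fs f0))

≢-opposite : (c : Fin 2) → c ≢ opposite c
≢-opposite f0      ()
≢-opposite (fs f0) ()

colourCount : Colouring → Fin 2 → List ℤ → ℕ
colourCount Δ c = count (λ z → Δ z ≟ c)

colourCount-own : ∀ Δ x xs → colourCount Δ (Δ x) (x ∷ xs) ≡ suc (colourCount Δ (Δ x) xs)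
colourCount-own Δ x xs = count-accept (λ z → Δ z ≟ Δ x) xs refl

colourCount-opposite : ∀ Δ x xs → colourCount Δ (opposite (Δ x)) (x ∷ xs) ≡ colourCount Δ (opposite (Δ x)) xs
colourCount-opposite Δ x xs = count-reject (λ z → Δ z ≟ opposite (Δ x)) xs (≢-opposite (Δ x))

colourCount-split : ∀ Δ xs → sumColours (λ c → colourCount Δ c xs) ≡ length xs
colourCount-split Δ []       = refl
colourCount-split Δ (x ∷ xs) = begin
  sumColours (λ c → colourCount Δ c (x ∷ xs))
    ≡⟨ sumColours-from (λ c → colourCount Δ c (x ∷ xs)) (Δ x) ⟩
  colourCount Δ (Δ x) (x ∷ xs) + colourCount Δ (opposite (Δ x)) (x ∷ xs)
    ≡⟨ cong₂ _+_ (colourCount-own Δ x xs) (colourCount-opposite Δ x xs) ⟩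
  suc (colourCount Δ (Δ x) xs + colourCount Δ (opposite (Δ x)) xs)
    ≡⟨ cong suc (sym (sumColours-from (λ c → colourCount Δ c xs) (Δ x))) ⟩
  suc (sumColours (λ c → colourCount Δ c xs))
    ≡⟨ cong suc (colourCount-split Δ xs) ⟩
  suc (length xs) ∎
  where open ≡-Reasoning

triangular-step : ∀ {k m} → m ≡ suc k → m + suc k C 2 ≡ suc m C 2
triangular-step {k} refl = trans (cong₂ _+_ (sym (nC1≡n (suc k))) refl) (nCk+nC[k+1]≡[n+1]C[k+1] (suc k) 1)

tetrahedral-step : ∀ {k m} → m ≡ suc k → suc m C 2 + (2 + k) C 3 ≡ (2 + m) C 3
tetrahedral-step {k} refl = nCk+nC[k+1]≡[n+1]C[k+1] (2 + k) 2

MonoPair : Colouring → Fin 2 → ℤ → ℤ → Set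
MonoPair Δ c y z = (y ℤ.≤ z) × (Δ y ≡ c) × (Δ z ≡ c)

monoPair? : ∀ Δ c y → Decidable (MonoPair Δ c y)
monoPair? Δ c y z = (y ℤ.≤? z) ×-dec (Δ y ≟ c) ×-dec (Δ z ≟ c)

pairCount : Colouring → Fin 2 → List ℤ → ℕ
pairCount Δ c ys = ∑[ y ∈ ys ] count (monoPair? Δ c y) ys

monoPairs-from : ∀ Δ {c} y {zs} → Δ y ≡ c → All (y ℤ.≤_) zs → count (monoPair? Δ c y) zs ≡ colourCount Δ c zs
monoPairs-from Δ y Δy≡c y≤zs =
  count-cong-local _ _ (All.map (λ y≤z → mk⇔ (proj₂ ∘ proj₂) (λ Δz≡c → y≤z , Δy≡c , Δz≡c)) y≤zs)

monoPairs-from-other : ∀ Δ {c} y zs → Δ y ≢ c → count (monoPair? Δ c y) zs ≡ 0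
monoPairs-from-other Δ y zs Δy≢c = count-none _ (All.universal (λ _ p → Δy≢c (proj₁ (proj₂ p))) zs)

pairCount-sorted : ∀ Δ c {ys} → AllPairs ℤ._<_ ys → pairCount Δ c ys ≡ suc (colourCount Δ c ys) C 2
pairCount-sorted Δ c []                           = refl
pairCount-sorted Δ c {y ∷ ys} (y<ys ∷ ys-sorted) = begin
  count (monoPair? Δ c y) (y ∷ ys) + ∑[ y′ ∈ ys ] count (monoPair? Δ c y′) (y ∷ ys)
    ≡⟨ cong₂ _+_ refl (∑-cong-local (All.map (λ y<y′ → count-reject _ ys (λ p → <⇒≱ y<y′ (proj₁ p))) y<ys)) ⟩
  count (monoPair? Δ c y) (y ∷ ys) + pairCount Δ c ys
    ≡⟨ cong₂ _+_ refl (pairCount-sorted Δ c ys-sorted) ⟩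
  count (monoPair? Δ c y) (y ∷ ys) + suc k C 2
    ≡⟨ pairsFrom-y (Δ y ≟ c) ⟩
  suc (colourCount Δ c (y ∷ ys)) C 2 ∎
  where
  open ≡-Reasoning
  k = colourCount Δ c ys
  pairsFrom-y : Dec (Δ y ≡ c) → count (monoPair? Δ c y) (y ∷ ys) + suc k C 2 ≡ suc (colourCount Δ c (y ∷ ys)) C 2
  pairsFrom-y (yes Δy≡c) = trans (cong₂ _+_ (monoPairs-from Δ y Δy≡c (≤-refl ∷ All.map <⇒≤ y<ys)) refl)
                                 (triangular-step {k} {colourCount Δ c (y ∷ ys)} (count-accept (λ z → Δ z ≟ c) ys Δy≡c))
  pairsFrom-y (no Δy≢c)  = trans (cong₂ _+_ (monoPairs-from-other Δ y (y ∷ ys) Δy≢c) refl)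
                                 (cong (λ n → suc n C 2) (sym (count-reject (λ z → Δ z ≟ c) ys Δy≢c)))

-- (2 + k) C 3 counts the 3-multisets of a k-set, i.e. the weakly increasing triples in a colour class of size k.
monoTriples : Colouring → List ℤ → ℕ
monoTriples Δ xs = sumColours (λ c → (2 + colourCount Δ c xs) C 3)

monoTriples-∷ : ∀ Δ x xs → suc (colourCount Δ (Δ x) (x ∷ xs)) C 2 + monoTriples Δ xs ≡ monoTriples Δ (x ∷ xs)
monoTriples-∷ Δ x xs = begin
  p + monoTriples Δ xs                               ≡⟨ cong (λ n → p + n) (sumColours-from (T xs) c) ⟩
  p + (T xs c + T xs (opposite c))                   ≡⟨ sym (+-assoc p _ _) ⟩
  p + T xs c + T xs (opposite c)                     ≡⟨ cong₂ _+_ (tetrahedral-step {colourCount Δ c xs} (colourCount-own Δ x xs))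
                                                                  (cong (λ n → (2 + n) C 3) (sym (colourCount-opposite Δ x xs))) ⟩
  T (x ∷ xs) c + T (x ∷ xs) (opposite c)             ≡⟨ sym (sumColours-from (T (x ∷ xs)) c) ⟩
  monoTriples Δ (x ∷ xs)                             ∎
  where
  open ≡-Reasoning
  c = Δ x
  p = suc (colourCount Δ c (x ∷ xs)) C 2
  T : List ℤ → Fin 2 → ℕ
  T ys c′ = (2 + colourCount Δ c′ ys) C 3

good⇔monoPair : ∀ Δ {x y z} → x ℤ.< 0ℤ → x ℤ.≤ y → Good Δ (x , y , z) ⇔ MonoPair Δ (Δ x) y z
good⇔monoPair Δ {x} {y} {z} x<0 x≤y = mk⇔
  (λ (_ , y≤z , _ , Δx≡Δy , Δy≡Δz) → y≤z , sym Δx≡Δy , sym (trans Δx≡Δy Δy≡Δz))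
  (λ (y≤z , Δy≡Δx , Δz≡Δx) → x≤y , y≤z , x+y<z y≤z , sym Δy≡Δx , trans Δy≡Δx (sym Δz≡Δx))
  where
  open ℤP.≤-Reasoning
  x+y<z : y ℤ.≤ z → x ℤ.+ y ℤ.< z
  x+y<z y≤z = begin-strict
    x ℤ.+ y   <⟨ +-monoˡ-< y x<0 ⟩
    0ℤ ℤ.+ y  ≡⟨ +-identityˡ y ⟩
    y         ≤⟨ y≤z ⟩
    z         ∎

tripleCount-good-∷ : ∀ Δ {x xs} → x ℤ.< 0ℤ → All (x ℤ.<_) xs →
                     tripleCount (good? Δ) (x ∷ xs) ≡ pairCount Δ (Δ x) (x ∷ xs) + tripleCount (good? Δ) xs
tripleCount-good-∷ Δ {x} {xs} x<0 x<xs =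
  trans (tripleCount-∷ (good? Δ) (λ (x₁≤x₂ , x₂≤x₃ , _) → x₁≤x₂ , x₂≤x₃) x<xs)
        (cong₂ _+_ (∑-cong-local (All.map triplesFrom-x (≤-refl ∷ All.map <⇒≤ x<xs))) refl)
  where
  triplesFrom-x : ∀ {y} → x ℤ.≤ y → count (λ z → good? Δ (x , y , z)) (x ∷ xs) ≡ count (monoPair? Δ (Δ x) y) (x ∷ xs)
  triplesFrom-x {y} x≤y = count-cong-local (λ z → good? Δ (x , y , z)) (monoPair? Δ (Δ x) y)
                                           (All.universal (λ _ → good⇔monoPair Δ x<0 x≤y) (x ∷ xs))

goodTriples+1≡monoTriples : ∀ Δ xs → AllPairs ℤ._<_ (xs ∷ʳ 0ℤ) →
                            tripleCount (good? Δ) (xs ∷ʳ 0ℤ) + 1 ≡ monoTriples Δ (xs ∷ʳ 0ℤ)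
goodTriples+1≡monoTriples Δ [] _ =
  sym (trans (sumColours-from (λ c → (2 + colourCount Δ c (0ℤ ∷ [])) C 3) (Δ 0ℤ))
             (cong₂ (λ k k′ → (2 + k) C 3 + (2 + k′) C 3) (colourCount-own Δ 0ℤ []) (colourCount-opposite Δ 0ℤ [])))
goodTriples+1≡monoTriples Δ (x ∷ xs) sorted@(x<ys ∷ ys-sorted) = begin
  tripleCount (good? Δ) (x ∷ ys) + 1
    ≡⟨ cong (λ n → n + 1) (tripleCount-good-∷ Δ x<0 x<ys) ⟩
  pairCount Δ (Δ x) (x ∷ ys) + tripleCount (good? Δ) ys + 1
    ≡⟨ +-assoc (pairCount Δ (Δ x) (x ∷ ys)) _ 1 ⟩
  pairCount Δ (Δ x) (x ∷ ys) + (tripleCount (good? Δ) ys + 1)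
    ≡⟨ cong₂ _+_ (pairCount-sorted Δ (Δ x) sorted) (goodTriples+1≡monoTriples Δ xs ys-sorted) ⟩
  suc (colourCount Δ (Δ x) (x ∷ ys)) C 2 + monoTriples Δ ys
    ≡⟨ monoTriples-∷ Δ x ys ⟩
  monoTriples Δ (x ∷ ys) ∎
  where
  open ≡-Reasoning
  ys = xs ∷ʳ 0ℤ
  x<0 = All.head (All.++⁻ʳ xs x<ys)

interval-sorted : ∀ a b → AllPairs ℤ._<_ [ a , b ]
interval-sorted a b with a ℤ.≤ᵇ b
... | true  = AllPairs.map⁺ (AllPairs.applyUpTo⁺₁ id _ (λ i<j _ → +-monoʳ-< a (+<+ i<j)))
... | false = []

-- For t = 2 + m the bounds 1 - t and -1 reduce to constructors, so both intervals unfold definitionally to map f (upTo _).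
interval-split : ∀ m → [ + 1 - + suc m , + 0 ] ≡ [ + 1 - + suc m , - + 1 ] ∷ʳ 0ℤ
interval-split zero    = refl
interval-split (suc m) =
  trans (cong (map f) (sym (upTo-∷ʳ (suc m))))
        (trans (map-++ f (upTo (suc m)) (suc m ∷ [])) (cong (map f (upTo (suc m)) ∷ʳ_) (+-inverseˡ (+ suc m))))
  where
  f : ℕ → ℤ
  f k = - + suc m ℤ.+ + k

length-interval : ∀ m → length [ + 1 - + suc m , + 0 ] ≡ suc m
length-interval zero    = refl
length-interval (suc m) = trans (length-map _ (upTo (suc (suc m)))) (length-upTo (suc (suc m)))

s₀≡colourCount : ∀ m Δ → s₀ (suc m) Δ ≡ colourCount Δ f0 ([ + 1 - + suc m , - + 1 ] ∷ʳ 0ℤ)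
s₀≡colourCount m Δ = sym (count-++ (λ z → Δ z ≟ f0) [ + 1 - + suc m , - + 1 ] (0ℤ ∷ []))

s₁≡colourCount : ∀ m Δ → s₁ (suc m) Δ ≡ colourCount Δ (fs f0) ([ + 1 - + suc m , - + 1 ] ∷ʳ 0ℤ)
s₁≡colourCount m Δ = begin
  suc m ∸ aCount (suc m) Δ ∸ eps Δ
    ≡⟨ ∸-+-assoc (suc m) (aCount (suc m) Δ) (eps Δ) ⟩
  suc m ∸ s₀ (suc m) Δ
    ≡⟨ cong₂ _∸_ (trans (sym (length-interval m)) (cong length (interval-split m))) (s₀≡colourCount m Δ) ⟩
  length L ∸ colourCount Δ f0 L
    ≡⟨ cong (_∸ colourCount Δ f0 L) (sym (colourCount-split Δ L)) ⟩
  colourCount Δ f0 L + colourCount Δ (fs f0) L ∸ colourCount Δ f0 L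
    ≡⟨ m+n∸m≡n (colourCount Δ f0 L) _ ⟩
  colourCount Δ (fs f0) L ∎
  where
  open ≡-Reasoning
  L = [ + 1 - + suc m , - + 1 ] ∷ʳ 0ℤ

-- n only bounds the domain of Δ, and t ≥ 2 is needed only as t ≢ 0.
lemma4p2 : (t n : ℕ) → t ≥ 2 → n ≥ t + 1 → (Δ : Colouring) →
    NQQQ t Δ ≡ ((s₀ t Δ + 2) C 3 + (s₁ t Δ + 2) C 3) ∸ 1
lemma4p2 zero    _ () _ Δ
lemma4p2 (suc m) _ _  _ Δ = begin
  NQQQ (suc m) Δ
    ≡⟨ count-triples (good? Δ) [ + 1 - + suc m , + 0 ] ⟩
  tripleCount (good? Δ) [ + 1 - + suc m , + 0 ]
    ≡⟨ cong (tripleCount (good? Δ)) (interval-split m) ⟩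
  tripleCount (good? Δ) L
    ≡⟨ sym (m+n∸n≡m (tripleCount (good? Δ) L) 1) ⟩
  tripleCount (good? Δ) L + 1 ∸ 1
    ≡⟨ cong (_∸ 1) (goodTriples+1≡monoTriples Δ [ + 1 - + suc m , - + 1 ] L-sorted) ⟩
  monoTriples Δ L ∸ 1
    ≡⟨ cong (_∸ 1) (cong₂ (λ k k′ → (2 + k) C 3 + (2 + k′) C 3) (sym (s₀≡colourCount m Δ)) (sym (s₁≡colourCount m Δ))) ⟩
  ((2 + s₀ (suc m) Δ) C 3 + (2 + s₁ (suc m) Δ) C 3) ∸ 1
    ≡⟨ cong (_∸ 1) (cong₂ (λ k k′ → k C 3 + k′ C 3) (+-comm 2 (s₀ (suc m) Δ)) (+-comm 2 (s₁ (suc m) Δ))) ⟩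
  ((s₀ (suc m) Δ + 2) C 3 + (s₁ (suc m) Δ + 2) C 3) ∸ 1 ∎
  where
  open ≡-Reasoning
  L = [ + 1 - + suc m , - + 1 ] ∷ʳ 0ℤ
  L-sorted : AllPairs ℤ._<_ L
  L-sorted = subst (AllPairs ℤ._<_) (interval-split m) (interval-sorted (+ 1 - + suc m) (+ 0))
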